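{- The vincular patterns $132\text{ - }4$ and $142\text{ - }3$ are Wilf-equivalent. Furthermore, for all $n\ge1$ and $a\in[n]$, the number of permutations in $\mathcal{S}_n$ avoiding $132\text{ - }4$ with first letter $a$ equals the number avoiding $142\text{ - }3$ with first letter $a$.
   Context: A vincular pattern is a permutation $\rho\in\mathcal{S}_m$ written with dashes between some consecutive entries; $\pi\in\mathcal{S}_n$ contains it if there are indices $i_1<\cdots<i_m$ with $\pi_{i_1}\cdots\pi_{i_m}$ order-isomorphic to $\rho$ and $i_{j+1}=i_j+1$ whenever $\rho_j,\rho_{j+1}$ are not separated by a dash; otherwise $\pi$ avoids it. Patterns are Wilf-equivalent if they are avoided by equally many permutations of length $n$ for every $n\ge0$. -}

module Defs where

open import Data.Nat using (ℕ; zero; suc; _<_)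
open import Data.Fin using (Fin; toℕ) renaming (_<_ to _<ᶠ_)
open import Data.Vec using (Vec; lookup; []; _∷_)
open import Data.Bool using (Bool; true; false)
open import Data.Product using (Σ; ∃; _×_)
open import Relation.Binary.PropositionalEquality using (_≡_)
open import Relation.Nullary using (¬_)

-- A permutation of length n, in one-line notation π = π₀ π₁ … π_{n-1}
-- (values 0-indexed in Fin n): a vector whose lookup is injective.
IsPerm : ∀ {n} → Vec (Fin n) n → Set
IsPerm {n} π = ∀ (i j : Fin n) → lookup π i ≡ lookup π j → i ≡ j

-- A vincular pattern of length m: an underlying permutation ρ ∈ S_m
-- (one-line notation) together with, for each position j, a flag
-- 'adj j' which is true iff ρ_j and ρ_{j+1} are NOT separated by a dash
-- (the flag at the last position is irrelevant).
record Vincular : Set where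
  constructor vincular
  field
    len  : ℕ
    ρ    : Vec (Fin len) len
    ρ-perm : IsPerm ρ
    adj  : Vec Bool len

open Vincular public

Contains : ∀ {n} → Vec (Fin n) n → Vincular → Set
Contains {n} π p =
  Σ (Fin (len p) → Fin n) λ f →
    (∀ j k → j <ᶠ k → f j <ᶠ f k)
    × (∀ j k → (lookup (ρ p) j <ᶠ lookup (ρ p) k → lookup π (f j) <ᶠ lookup π (f k))
             × (lookup π (f j) <ᶠ lookup π (f k) → lookup (ρ p) j <ᶠ lookup (ρ p) k))
    × (∀ j k → toℕ k ≡ suc (toℕ j) → lookup (adj p) j ≡ true
             → toℕ (f k) ≡ suc (toℕ (f j)))

Avoids : ∀ {n} → Vec (Fin n) n → Vincular → Set
Avoids π p = ¬ Contains π p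

-- The set of permutations in S_n avoiding p.  The proof fields are
-- irrelevant, so two elements are equal iff their underlying one-line
-- words are equal; hence this type has exactly |S_n(p)| elements.
record Av (n : ℕ) (p : Vincular) : Set where
  constructor av
  field
    word    : Vec (Fin n) n
    .isPerm : IsPerm word
    .avoids : Avoids word p

record AvFirst (k : ℕ) (a : Fin (suc k)) (p : Vincular) : Set where
  constructor avf
  field
    word    : Vec (Fin (suc k)) (suc k)
    .isPerm : IsPerm word
    .avoids : Avoids word p
    .first  : lookup word Fin.zero ≡ a

private
  f0 f1 f2 f3 : Fin 4
  f0 = Fin.zero
  f1 = Fin.suc Fin.zero
  f2 = Fin.suc (Fin.suc Fin.zero)
  f3 = Fin.suc (Fin.suc (Fin.suc Fin.zero))

perm-1324 : IsPerm (f0 ∷ f2 ∷ f1 ∷ f3 ∷ [])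
perm-1324 Fin.zero Fin.zero e = Relation.Binary.PropositionalEquality.refl
perm-1324 Fin.zero (Fin.suc Fin.zero) ()
perm-1324 Fin.zero (Fin.suc (Fin.suc Fin.zero)) ()
perm-1324 Fin.zero (Fin.suc (Fin.suc (Fin.suc Fin.zero))) ()
perm-1324 (Fin.suc Fin.zero) Fin.zero ()
perm-1324 (Fin.suc Fin.zero) (Fin.suc Fin.zero) e = Relation.Binary.PropositionalEquality.refl
perm-1324 (Fin.suc Fin.zero) (Fin.suc (Fin.suc Fin.zero)) ()
perm-1324 (Fin.suc Fin.zero) (Fin.suc (Fin.suc (Fin.suc Fin.zero))) ()
perm-1324 (Fin.suc (Fin.suc Fin.zero)) Fin.zero ()
perm-1324 (Fin.suc (Fin.suc Fin.zero)) (Fin.suc Fin.zero) ()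
perm-1324 (Fin.suc (Fin.suc Fin.zero)) (Fin.suc (Fin.suc Fin.zero)) e = Relation.Binary.PropositionalEquality.refl
perm-1324 (Fin.suc (Fin.suc Fin.zero)) (Fin.suc (Fin.suc (Fin.suc Fin.zero))) ()
perm-1324 (Fin.suc (Fin.suc (Fin.suc Fin.zero))) Fin.zero ()
perm-1324 (Fin.suc (Fin.suc (Fin.suc Fin.zero))) (Fin.suc Fin.zero) ()
perm-1324 (Fin.suc (Fin.suc (Fin.suc Fin.zero))) (Fin.suc (Fin.suc Fin.zero)) ()
perm-1324 (Fin.suc (Fin.suc (Fin.suc Fin.zero))) (Fin.suc (Fin.suc (Fin.suc Fin.zero))) e = Relation.Binary.PropositionalEquality.refl

perm-1423 : IsPerm (f0 ∷ f3 ∷ f1 ∷ f2 ∷ [])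
perm-1423 Fin.zero Fin.zero e = Relation.Binary.PropositionalEquality.refl
perm-1423 Fin.zero (Fin.suc Fin.zero) ()
perm-1423 Fin.zero (Fin.suc (Fin.suc Fin.zero)) ()
perm-1423 Fin.zero (Fin.suc (Fin.suc (Fin.suc Fin.zero))) ()
perm-1423 (Fin.suc Fin.zero) Fin.zero ()
perm-1423 (Fin.suc Fin.zero) (Fin.suc Fin.zero) e = Relation.Binary.PropositionalEquality.refl
perm-1423 (Fin.suc Fin.zero) (Fin.suc (Fin.suc Fin.zero)) ()
perm-1423 (Fin.suc Fin.zero) (Fin.suc (Fin.suc (Fin.suc Fin.zero))) ()
perm-1423 (Fin.suc (Fin.suc Fin.zero)) Fin.zero ()
perm-1423 (Fin.suc (Fin.suc Fin.zero)) (Fin.suc Fin.zero) ()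
perm-1423 (Fin.suc (Fin.suc Fin.zero)) (Fin.suc (Fin.suc Fin.zero)) e = Relation.Binary.PropositionalEquality.refl
perm-1423 (Fin.suc (Fin.suc Fin.zero)) (Fin.suc (Fin.suc (Fin.suc Fin.zero))) ()
perm-1423 (Fin.suc (Fin.suc (Fin.suc Fin.zero))) Fin.zero ()
perm-1423 (Fin.suc (Fin.suc (Fin.suc Fin.zero))) (Fin.suc Fin.zero) ()
perm-1423 (Fin.suc (Fin.suc (Fin.suc Fin.zero))) (Fin.suc (Fin.suc Fin.zero)) ()
perm-1423 (Fin.suc (Fin.suc (Fin.suc Fin.zero))) (Fin.suc (Fin.suc (Fin.suc Fin.zero))) e = Relation.Binary.PropositionalEquality.refl

p132-4 : Vincular
p132-4 = vincular 4 (f0 ∷ f2 ∷ f1 ∷ f3 ∷ []) perm-1324 (true ∷ true ∷ false ∷ false ∷ [])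

p142-3 : Vincular
p142-3 = vincular 4 (f0 ∷ f3 ∷ f1 ∷ f2 ∷ []) perm-1423 (true ∷ true ∷ false ∷ false ∷ [])

module Submission where

-- Encode a permutation π of length n by its Lehmer code c, where c j is the rank of π_j among
-- π_j, …, π_{n-1}.  An occurrence of 132-4 or of 142-3 begins with a consecutive 132
-- π_{j-1} π_j π_{j+1}, which the code sees locally as c (j-1) ≤ c (j+1) < c j.  At such a 132 there is
-- no occurrence of 132-4 iff π_j is the largest of π_j, …, π_{n-1}, i.e. c j = n-1-j, and none of 142-3
-- iff π_j is the successor of π_{j+1} among them, i.e. c j = c (j+1) + 1.  Overwriting c j by the value
-- required for one pattern at every consecutive 132 creates and destroys no consecutive 132, so doing
-- it for 132-4 and for 142-3 are mutually inverse bijections between the codes of the two avoidance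
-- classes.  Since c 0 is never overwritten, the first letter is preserved.

open import Defs
open import Data.Nat using (ℕ; zero; suc; _+_; _∸_; _≤_; _<_; z≤n; s≤s; z<s; s<s; s≤s⁻¹; s<s⁻¹)
import Data.Nat.Properties as ℕ
open import Data.Fin using (Fin; zero; suc; toℕ; fromℕ; fromℕ<; punchIn; punchOut) renaming (_<_ to _<ᶠ_)
import Data.Fin.Properties as Fin
open import Data.Fin.Patterns using (0F; 1F; 2F; 3F)
open import Data.Vec using (Vec; []; _∷_; lookup; map)
open import Data.Vec.Properties using (lookup-map; ≡-dec)
open import Data.Bool using (true; false)
open import Data.Product using (Σ; _×_; _,_; proj₁; proj₂)
open import Data.Sum using (_⊎_; inj₁; inj₂)
import Data.Sum as Sum
open import Data.Empty using (⊥; ⊥-elim)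
open import Function using (_∘_)
open import Function.Bundles using (_↔_; mk↔ₛ′)
open import Relation.Binary using (tri<; tri≈; tri>)
open import Relation.Binary.PropositionalEquality
open import Relation.Nullary using (¬_; Dec; yes; no)
open import Relation.Nullary.Decidable using (_×-dec_; recompute)

-- Occurrences of a pattern ρ₁ρ₂ρ₃-ρ₄

Increasing : ∀ {m n} → (Fin m → Fin n) → Set
Increasing f = ∀ j k → j <ᶠ k → f j <ᶠ f k

Similar : ∀ {m n} → Vec (Fin m) m → (Fin m → Fin n) → Set
Similar ρ u = ∀ j k → (lookup ρ j <ᶠ lookup ρ k → u j <ᶠ u k) × (u j <ᶠ u k → lookup ρ j <ᶠ lookup ρ k)

RespectsAdjacency : ∀ {m n} → Vec _ m → (Fin m → Fin n) → Set
RespectsAdjacency adj f = ∀ j k → toℕ k ≡ suc (toℕ j) → lookup adj j ≡ true → toℕ (f k) ≡ suc (toℕ (f j))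

-- Containment in a word of arbitrary length; for m = n this is Defs.Contains.
Contains′ : ∀ {n m} → Vec (Fin n) m → Vincular → Set
Contains′ {m = m} v p =
  Σ (Fin (len p) → Fin m) λ f → Increasing f × Similar (ρ p) (lookup v ∘ f) × RespectsAdjacency (adj p) f

Increasing⇒injective : ∀ {m n} {f : Fin m → Fin n} → Increasing f → ∀ {j k} → f j ≡ f k → j ≡ k
Increasing⇒injective {f = f} inc {j} {k} eq with ℕ.<-cmp (toℕ j) (toℕ k)
... | tri< j<k _ _ = ⊥-elim (Fin.<⇒≢ (inc j k j<k) eq)
... | tri≈ _ j≡k _ = Fin.toℕ-injective j≡k
... | tri> _ _ k<j = ⊥-elim (Fin.<⇒≢ (inc k j k<j) (sym eq))

Contains′⇒length≥ : ∀ {n m} {v : Vec (Fin n) m} {p} → Contains′ v p → len p ≤ m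
Contains′⇒length≥ (f , inc , _) = Fin.injective⇒≤ (Increasing⇒injective inc)

Increasing⇒Similar : ∀ {m n} (ρ : Vec (Fin m) m) {u : Fin m → Fin n} → Increasing u → Similar ρ (u ∘ lookup ρ)
Increasing⇒Similar ρ {u} inc j k = inc _ _ , reflect
  where
  reflect : u (lookup ρ j) <ᶠ u (lookup ρ k) → lookup ρ j <ᶠ lookup ρ k
  reflect lt with ℕ.<-cmp (toℕ (lookup ρ j)) (toℕ (lookup ρ k))
  ... | tri< ρj<ρk _ _ = ρj<ρk
  ... | tri≈ _ ρj≡ρk _ rewrite Fin.toℕ-injective ρj≡ρk = ⊥-elim (ℕ.<-irrefl refl lt)
  ... | tri> _ _ ρk<ρj = ⊥-elim (ℕ.<-asym lt (inc _ _ ρk<ρj))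

Similar-cong : ∀ {m n} {ρ : Vec (Fin m) m} {u u′ : Fin m → Fin n} → (∀ j → u j ≡ u′ j) → Similar ρ u → Similar ρ u′
Similar-cong eq sim j k = (λ lt → subst₂ _<ᶠ_ (eq j) (eq k) (proj₁ (sim j k) lt))
                        , (λ lt → proj₂ (sim j k) (subst₂ _<ᶠ_ (sym (eq j)) (sym (eq k)) lt))

Increasing-steps : ∀ {n} (u : Fin 4 → Fin n) → u 0F <ᶠ u 1F → u 1F <ᶠ u 2F → u 2F <ᶠ u 3F → Increasing u
Increasing-steps u u01 u12 u23 = λ where
  0F 1F _ → u01
  0F 2F _ → ℕ.<-trans u01 u12
  0F 3F _ → ℕ.<-trans u01 (ℕ.<-trans u12 u23)
  1F 2F _ → u12
  1F 3F _ → ℕ.<-trans u12 u23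
  2F 3F _ → u23
  0F 0F ()
  1F 0F ()
  2F 0F ()
  3F 0F ()
  1F 1F (s≤s ())
  2F 1F (s≤s ())
  3F 1F (s≤s ())
  2F 2F (s≤s (s≤s ()))
  3F 2F (s≤s (s≤s ()))
  3F 3F (s≤s (s≤s (s≤s ())))

Contains′-∷ : ∀ {n m} {x : Fin n} {v : Vec (Fin n) m} {p} → Contains′ v p → Contains′ (x ∷ v) p
Contains′-∷ (f , inc , sim , tight) = suc ∘ f , (λ j k → s<s ∘ inc j k) , sim , (λ j k e a → cong suc (tight j k e a))

Contains′-tail : ∀ {n m} {x : Fin n} {v : Vec (Fin n) m} {p} (c : Contains′ (x ∷ v) p) →
                 (∀ j → proj₁ c j ≢ zero) → Contains′ v p
Contains′-tail {m = m} {x = x} {v} {p} (f , inc , sim , tight) f≢0 = g , inc′ , Similar-cong {ρ = ρ p} lookup-g sim , adj′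
  where
  g : Fin (len p) → Fin m
  g j = punchOut (f≢0 j ∘ sym)
  suc-g : ∀ j → suc (g j) ≡ f j
  suc-g j = Fin.punchIn-punchOut (f≢0 j ∘ sym)
  lookup-g : ∀ j → lookup (x ∷ v) (f j) ≡ lookup v (g j)
  lookup-g j = cong (lookup (x ∷ v)) (sym (suc-g j))
  inc′ : Increasing g
  inc′ j k j<k = s<s⁻¹ (subst₂ _<ᶠ_ (sym (suc-g j)) (sym (suc-g k)) (inc j k j<k))
  adj′ : RespectsAdjacency (adj p) g
  adj′ j k e a = ℕ.suc-injective (begin
    suc (toℕ (g k))   ≡⟨ cong toℕ (suc-g k) ⟩
    toℕ (f k)         ≡⟨ tight j k e a ⟩
    suc (toℕ (f j))   ≡⟨ cong (suc ∘ toℕ) (sym (suc-g j)) ⟩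
    suc (suc (toℕ (g j))) ∎)
    where open ≡-Reasoning

abc-d : (ρ : Vec (Fin 4) 4) → IsPerm ρ → Vincular
abc-d ρ ρ-perm = vincular 4 ρ ρ-perm (true ∷ true ∷ false ∷ false ∷ [])

module _ {n} (Q : Fin n → Fin n → Fin n → Fin n → Set) where

  OccursAtHead : ∀ {k} → Fin n → Fin n → Fin n → Vec (Fin n) k → Set
  OccursAtHead x y z r = Σ (Fin _) λ t → Q x y z (lookup r t)

  Occurs : ∀ {m} → Vec (Fin n) m → Set
  Occurs (x ∷ y ∷ z ∷ r) = OccursAtHead x y z r ⊎ Occurs (y ∷ z ∷ r)
  Occurs _ = ⊥

positions : ∀ {k} → Fin k → Fin 4 → Fin (3 + k)
positions t = lookup (0F ∷ 1F ∷ 2F ∷ suc (suc (suc t)) ∷ [])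

positions-increasing : ∀ {k} (t : Fin k) → Increasing (positions t)
positions-increasing t = Increasing-steps (positions t) z<s (s<s z<s) (s<s (s<s z<s))

positions-tight : ∀ {k} (t : Fin k) → RespectsAdjacency (true ∷ true ∷ false ∷ false ∷ []) (positions t)
positions-tight t 0F 1F _ _ = refl
positions-tight t 1F 2F _ _ = refl
positions-tight t 0F 0F () _
positions-tight t 0F 2F () _
positions-tight t 0F 3F () _
positions-tight t 1F 0F () _
positions-tight t 1F 1F () _
positions-tight t 1F 3F () _
positions-tight t 2F _ _ ()
positions-tight t 3F _ _ ()

lookup-positions : ∀ {n k} (x y z : Fin n) (r : Vec (Fin n) k) t j →
                   lookup (x ∷ y ∷ z ∷ r) (positions t j) ≡ lookup (x ∷ y ∷ z ∷ lookup r t ∷ []) j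
lookup-positions x y z r t 0F = refl
lookup-positions x y z r t 1F = refl
lookup-positions x y z r t 2F = refl
lookup-positions x y z r t 3F = refl

above-2 : ∀ {k} (i : Fin (3 + k)) → 2 < toℕ i → Σ (Fin k) λ t → i ≡ suc (suc (suc t))
above-2 (suc (suc (suc t))) _ = t , refl
above-2 0F ()
above-2 1F (s≤s ())
above-2 2F (s≤s (s≤s ()))

anchored : ∀ {k} (f : Fin 4 → Fin (3 + k)) → Increasing f → RespectsAdjacency (true ∷ true ∷ false ∷ false ∷ []) f →
           f 0F ≡ 0F → Σ (Fin k) λ t → ∀ j → f j ≡ positions t j
anchored {k} f inc tight f0 = proj₁ f3 , λ where
    0F → f0
    1F → Fin.toℕ-injective f1
    2F → Fin.toℕ-injective f2
    3F → proj₂ f3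
  where
  f1 : toℕ (f 1F) ≡ 1
  f1 = trans (tight 0F 1F refl refl) (cong (suc ∘ toℕ) f0)
  f2 : toℕ (f 2F) ≡ 2
  f2 = trans (tight 1F 2F refl refl) (cong suc f1)
  f3 : Σ (Fin k) λ t → f 3F ≡ suc (suc (suc t))
  f3 = above-2 (f 3F) (subst (_< toℕ (f 3F)) f2 (inc 2F 3F (s<s (s<s z<s))))

module _ (ρ : Vec (Fin 4) 4) (ρ-perm : IsPerm ρ) {n} (Q : Fin n → Fin n → Fin n → Fin n → Set) where

  private
    p : Vincular
    p = abc-d ρ ρ-perm

  Contains′-uncons : ∀ {k} {x y z : Fin n} {r : Vec (Fin n) k} → Contains′ (x ∷ y ∷ z ∷ r) p →
                     (Σ (Fin k) λ t → Similar ρ (lookup (x ∷ y ∷ z ∷ lookup r t ∷ []))) ⊎ Contains′ (y ∷ z ∷ r) p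
  Contains′-uncons {x = x} {y} {z} {r} c@(f , inc , sim , tight) with f 0F in f0
  ... | zero  =
    let (t , f≗) = anchored f inc tight f0
    in inj₁ (t , Similar-cong {ρ = ρ} (λ j → trans (cong (lookup (x ∷ y ∷ z ∷ r)) (f≗ j)) (lookup-positions x y z r t j)) sim)
  ... | suc _ = inj₂ (Contains′-tail {x = x} {v = y ∷ z ∷ r} {p = p} c f≢0)
    where
    f≢0 : ∀ j → f j ≢ zero
    f≢0 0F e with () ← trans (sym f0) e
    f≢0 j@(suc _) e with () ← subst (f 0F <ᶠ_) e (inc 0F j z<s)

  Contains⇒Occurs : (∀ x y z w → Similar ρ (lookup (x ∷ y ∷ z ∷ w ∷ [])) → Q x y z w) →
                    ∀ {m} (v : Vec (Fin n) m) → Contains′ v p → Occurs Q v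
  Contains⇒Occurs _ [] c with Contains′⇒length≥ {v = []} {p = p} c
  ... | ()
  Contains⇒Occurs _ v@(_ ∷ []) c with Contains′⇒length≥ {v = v} {p = p} c
  ... | s≤s ()
  Contains⇒Occurs _ v@(_ ∷ _ ∷ []) c with Contains′⇒length≥ {v = v} {p = p} c
  ... | s≤s (s≤s ())
  Contains⇒Occurs similar⇒Q (x ∷ y ∷ z ∷ r) c =
    Sum.map (λ (t , sim) → t , similar⇒Q x y z (lookup r t) sim) (Contains⇒Occurs similar⇒Q (y ∷ z ∷ r))
            (Contains′-uncons c)

  Occurs⇒Contains : (∀ x y z w → Q x y z w → Similar ρ (lookup (x ∷ y ∷ z ∷ w ∷ []))) →
                    ∀ {m} (v : Vec (Fin n) m) → Occurs Q v → Contains′ v (abc-d ρ ρ-perm)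
  Occurs⇒Contains Q⇒similar (x ∷ y ∷ z ∷ r) (inj₁ (t , q)) =
    positions t , positions-increasing t ,
    Similar-cong {ρ = ρ} (sym ∘ lookup-positions x y z r t) (Q⇒similar x y z (lookup r t) q) , positions-tight t
  Occurs⇒Contains Q⇒similar (x ∷ y ∷ z ∷ r) (inj₂ o) = Contains′-∷ {p = p} (Occurs⇒Contains Q⇒similar (y ∷ z ∷ r) o)

data Pattern : Set where
  132-4 142-3 : Pattern

⟦_⟧ : Pattern → Vincular
⟦ 132-4 ⟧ = p132-4
⟦ 142-3 ⟧ = p142-3

underlying : Pattern → Vec (Fin 4) 4
underlying 132-4 = ρ p132-4
underlying 142-3 = ρ p142-3

Shape : Pattern → ∀ {n} → Fin n → Fin n → Fin n → Fin n → Set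
Shape 132-4 x y z w = x <ᶠ z × z <ᶠ y × y <ᶠ w
Shape 142-3 x y z w = x <ᶠ z × z <ᶠ w × w <ᶠ y

Shape⇒Similar : ∀ P {n} (x y z w : Fin n) → Shape P x y z w → Similar (underlying P) (lookup (x ∷ y ∷ z ∷ w ∷ []))
Shape⇒Similar 132-4 x y z w (x<z , z<y , y<w) =
  Similar-cong {ρ = ρ p132-4} (λ { 0F → refl ; 1F → refl ; 2F → refl ; 3F → refl })
    (Increasing⇒Similar (ρ p132-4) (Increasing-steps (lookup (x ∷ z ∷ y ∷ w ∷ [])) x<z z<y y<w))
Shape⇒Similar 142-3 x y z w (x<z , z<w , w<y) =
  Similar-cong {ρ = ρ p142-3} (λ { 0F → refl ; 1F → refl ; 2F → refl ; 3F → refl })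
    (Increasing⇒Similar (ρ p142-3) (Increasing-steps (lookup (x ∷ z ∷ w ∷ y ∷ [])) x<z z<w w<y))

Similar⇒Shape : ∀ P {n} (x y z w : Fin n) → Similar (underlying P) (lookup (x ∷ y ∷ z ∷ w ∷ [])) → Shape P x y z w
Similar⇒Shape 132-4 x y z w sim = proj₁ (sim 0F 2F) z<s , proj₁ (sim 2F 1F) (s<s z<s) , proj₁ (sim 1F 3F) (s<s (s<s z<s))
Similar⇒Shape 142-3 x y z w sim = proj₁ (sim 0F 2F) z<s , proj₁ (sim 2F 3F) (s<s z<s) , proj₁ (sim 3F 1F) (s<s (s<s z<s))

Contains⇒Shape : ∀ P {n} (π : Vec (Fin n) n) → Contains π ⟦ P ⟧ → Occurs (Shape P) π
Contains⇒Shape 132-4 = Contains⇒Occurs (ρ p132-4) (ρ-perm p132-4) (Shape 132-4) (Similar⇒Shape 132-4)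
Contains⇒Shape 142-3 = Contains⇒Occurs (ρ p142-3) (ρ-perm p142-3) (Shape 142-3) (Similar⇒Shape 142-3)

Shape⇒Contains : ∀ P {n} (π : Vec (Fin n) n) → Occurs (Shape P) π → Contains π ⟦ P ⟧
Shape⇒Contains 132-4 = Occurs⇒Contains (ρ p132-4) (ρ-perm p132-4) (Shape 132-4) (Shape⇒Similar 132-4)
Shape⇒Contains 142-3 = Occurs⇒Contains (ρ p142-3) (ρ-perm p142-3) (Shape 142-3) (Shape⇒Similar 142-3)

module _ {n n′} (g : Fin n → Fin n′) {Q : Fin n → Fin n → Fin n → Fin n → Set} {Q′ : Fin n′ → Fin n′ → Fin n′ → Fin n′ → Set} where

  Occurs-map : (∀ {x y z w} → Q x y z w → Q′ (g x) (g y) (g z) (g w)) →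
               ∀ {m} (v : Vec (Fin n) m) → Occurs Q v → Occurs Q′ (map g v)
  Occurs-map h (x ∷ y ∷ z ∷ r) (inj₁ (t , q)) = inj₁ (t , subst (Q′ (g x) (g y) (g z)) (sym (lookup-map t g r)) (h q))
  Occurs-map h (x ∷ y ∷ z ∷ r) (inj₂ o)       = inj₂ (Occurs-map h (y ∷ z ∷ r) o)

  Occurs-unmap : (∀ {x y z w} → Q′ (g x) (g y) (g z) (g w) → Q x y z w) →
                 ∀ {m} (v : Vec (Fin n) m) → Occurs Q′ (map g v) → Occurs Q v
  Occurs-unmap h (x ∷ y ∷ z ∷ r) (inj₁ (t , q)) = inj₁ (t , h (subst (Q′ (g x) (g y) (g z)) (lookup-map t g r) q))
  Occurs-unmap h (x ∷ y ∷ z ∷ r) (inj₂ o)       = inj₂ (Occurs-unmap h (y ∷ z ∷ r) o)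

Occurs-∷ : ∀ {n m} {Q : Fin n → Fin n → Fin n → Fin n → Set} (x : Fin n) (v : Vec (Fin n) m) → Occurs Q v → Occurs Q (x ∷ v)
Occurs-∷ x (y ∷ z ∷ r) o = inj₂ o

punchIn-mono-< : ∀ {n} (i : Fin (suc n)) {j k : Fin n} → j <ᶠ k → punchIn i j <ᶠ punchIn i k
punchIn-mono-< i {j} {k} j<k = ℕ.≰⇒> (ℕ.<⇒≱ j<k ∘ Fin.punchIn-cancel-≤ i k j)

punchIn-cancel-< : ∀ {n} (i : Fin (suc n)) {j k : Fin n} → punchIn i j <ᶠ punchIn i k → j <ᶠ k
punchIn-cancel-< i {j} {k} lt = ℕ.≰⇒> (ℕ.<⇒≱ lt ∘ Fin.punchIn-mono-≤ i k j)

module _ {n n′} {g : Fin n → Fin n′} where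

  Shape-map : ∀ P → (∀ {a b} → a <ᶠ b → g a <ᶠ g b) → ∀ {x y z w} → Shape P x y z w → Shape P (g x) (g y) (g z) (g w)
  Shape-map 132-4 mono (lt₁ , lt₂ , lt₃) = mono lt₁ , mono lt₂ , mono lt₃
  Shape-map 142-3 mono (lt₁ , lt₂ , lt₃) = mono lt₁ , mono lt₂ , mono lt₃

  Shape-unmap : ∀ P → (∀ {a b} → g a <ᶠ g b → a <ᶠ b) → ∀ {x y z w} → Shape P (g x) (g y) (g z) (g w) → Shape P x y z w
  Shape-unmap 132-4 refl< (lt₁ , lt₂ , lt₃) = refl< lt₁ , refl< lt₂ , refl< lt₃
  Shape-unmap 142-3 refl< (lt₁ , lt₂ , lt₃) = refl< lt₁ , refl< lt₂ , refl< lt₃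

Occurs-punchIn : ∀ P {n m} (i : Fin (suc n)) (v : Vec (Fin n) m) → Occurs (Shape P) v → Occurs (Shape P) (map (punchIn i) v)
Occurs-punchIn P i = Occurs-map (punchIn i) (Shape-map P (punchIn-mono-< i))

Occurs-unpunchIn : ∀ P {n m} (i : Fin (suc n)) (v : Vec (Fin n) m) → Occurs (Shape P) (map (punchIn i) v) → Occurs (Shape P) v
Occurs-unpunchIn P i = Occurs-unmap (punchIn i) (Shape-unmap P (punchIn-cancel-< i))

-- Lehmer codes

-- Letter j of the decoded word has rank c j among letters j, …, n-1; entries c j with j ≥ n are ignored.
IsCode : ℕ → (ℕ → ℕ) → Set
IsCode n c = ∀ j → j < n → c j + j < n

IsCode-head : ∀ {n c} → IsCode (suc n) c → c 0 < suc n
IsCode-head {n} {c} code = subst (_< suc n) (ℕ.+-identityʳ (c 0)) (code 0 z<s)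

IsCode-tail : ∀ {n c} → IsCode (suc n) c → IsCode n (c ∘ suc)
IsCode-tail {n} {c} code j j<n = s<s⁻¹ (subst (_< suc n) (ℕ.+-suc (c (suc j)) j) (code (suc j) (s<s j<n)))

decode : ∀ n (c : ℕ → ℕ) → .(IsCode n c) → Vec (Fin n) n
decode zero    c _    = []
decode (suc n) c code = a ∷ map (punchIn a) (decode n (c ∘ suc) (IsCode-tail code))
  where a = fromℕ< (IsCode-head code)

decode-isPerm : ∀ n c .(code : IsCode n c) → IsPerm (decode n c code)
decode-isPerm (suc n) c code = λ where
    zero    zero    _ → refl
    zero    (suc j) e → ⊥-elim (Fin.punchInᵢ≢i _ _ (sym (trans e (lookup-map j _ W))))
    (suc i) zero    e → ⊥-elim (Fin.punchInᵢ≢i _ _ (trans (sym (lookup-map i _ W)) e))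
    (suc i) (suc j) e → cong suc (decode-isPerm n (c ∘ suc) (IsCode-tail code) i j
                          (Fin.punchIn-injective _ _ _ (trans (sym (lookup-map i _ W)) (trans e (lookup-map j _ W)))))
  where W = decode n (c ∘ suc) (IsCode-tail code)

decode-surjective : ∀ n c .(code : IsCode n c) (t : Fin n) → Σ (Fin n) λ k → lookup (decode n c code) k ≡ t
decode-surjective (suc n) c code t with fromℕ< (IsCode-head code) Fin.≟ t
... | yes a≡t = zero , a≡t
... | no a≢t with k , e ← decode-surjective n (c ∘ suc) (IsCode-tail code) (punchOut a≢t) =
  suc k , trans (lookup-map k _ (decode n (c ∘ suc) (IsCode-tail code)))
                (trans (cong (punchIn _) e) (Fin.punchIn-punchOut a≢t))

decode-cong : ∀ n c c′ .(code : IsCode n c) .(code′ : IsCode n c′) → (∀ j → j < n → c j ≡ c′ j) →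
              decode n c code ≡ decode n c′ code′
decode-cong zero    c c′ _    _     _  = refl
decode-cong (suc n) c c′ code code′ eq =
  cong₂ (λ a W → a ∷ map (punchIn a) W) (Fin.fromℕ<-cong (c 0) (c′ 0) (eq 0 z<s) _ _)
        (decode-cong n _ _ (IsCode-tail code) (IsCode-tail code′) (λ j j<n → eq (suc j) (s<s j<n)))

-- punchOut i, extended by a junk value at i itself.
punchOut′ : ∀ {m} → Fin (suc (suc m)) → Fin (suc (suc m)) → Fin (suc m)
punchOut′ i j with i Fin.≟ j
... | yes _   = zero
... | no i≢j = punchOut i≢j

punchOut′-punchIn : ∀ {m} (i : Fin (suc (suc m))) k → punchOut′ i (punchIn i k) ≡ k
punchOut′-punchIn i k with i Fin.≟ punchIn i k
... | yes e = ⊥-elim (Fin.punchInᵢ≢i i k (sym e))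
... | no _  = trans (Fin.punchOut-cong i refl) (Fin.punchOut-punchIn i)

punchIn-punchOut′ : ∀ {m} {i j : Fin (suc (suc m))} → i ≢ j → punchIn i (punchOut′ i j) ≡ j
punchIn-punchOut′ {i = i} {j} i≢j with i Fin.≟ j
... | yes i≡j = ⊥-elim (i≢j i≡j)
... | no i≢j′ = Fin.punchIn-punchOut i≢j′

encode : ∀ {n} → Vec (Fin n) n → ℕ → ℕ
encode []                          _       = 0
encode (x ∷ _)                     zero    = toℕ x
encode {1}           (_ ∷ [])      (suc _) = 0
encode {suc (suc _)} (x ∷ xs)      (suc j) = encode (map (punchOut′ x) xs) j

encode-isCode : ∀ {n} (π : Vec (Fin n) n) → IsCode n (encode π)
encode-isCode (x ∷ [])   zero    _ = subst (_< 1) (sym (ℕ.+-identityʳ (toℕ x))) (Fin.toℕ<n x)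
encode-isCode (x ∷ [])   (suc j) (s<s ())
encode-isCode {suc (suc m)} (x ∷ xs) zero _ = subst (_< suc (suc m)) (sym (ℕ.+-identityʳ (toℕ x))) (Fin.toℕ<n x)
encode-isCode {suc (suc m)} (x ∷ xs) (suc j) (s<s j<n) =
  subst (_< suc (suc m)) (sym (ℕ.+-suc (encode (map (punchOut′ x) xs) j) j)) (s<s (encode-isCode (map (punchOut′ x) xs) j j<n))

map-punchIn-punchOut′ : ∀ {m k} (x : Fin (suc (suc m))) (zs : Vec (Fin (suc (suc m))) k) →
                        (∀ i → x ≢ lookup zs i) → map (punchIn x) (map (punchOut′ x) zs) ≡ zs
map-punchIn-punchOut′ x []       _   = refl
map-punchIn-punchOut′ x (z ∷ zs) x∉ = cong₂ _∷_ (punchIn-punchOut′ (x∉ zero)) (map-punchIn-punchOut′ x zs (x∉ ∘ suc))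

map-punchOut′-punchIn : ∀ {m k} (x : Fin (suc (suc m))) (zs : Vec (Fin (suc m)) k) → map (punchOut′ x) (map (punchIn x) zs) ≡ zs
map-punchOut′-punchIn x []       = refl
map-punchOut′-punchIn x (z ∷ zs) = cong₂ _∷_ (punchOut′-punchIn x z) (map-punchOut′-punchIn x zs)

decode-encode : ∀ {n} (π : Vec (Fin n) n) → IsPerm π → .(code : IsCode n (encode π)) → decode n (encode π) code ≡ π
decode-encode []       _    _ = refl
decode-encode (x ∷ []) _    _ = cong (_∷ []) (Fin.fromℕ<-toℕ x _)
decode-encode {suc (suc m)} (x ∷ xs) perm _ =
  trans (cong₂ (λ a W → a ∷ map (punchIn a) W) (Fin.fromℕ<-toℕ x _) (decode-encode ys ys-perm (encode-isCode ys)))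
        (cong (x ∷_) (map-punchIn-punchOut′ x xs x∉))
  where
  ys : Vec (Fin (suc m)) (suc m)
  ys = map (punchOut′ x) xs
  x∉ : ∀ i → x ≢ lookup xs i
  x∉ i e with () ← perm zero (suc i) e
  ys-perm : IsPerm ys
  ys-perm i j e = Fin.suc-injective (perm (suc i) (suc j) (begin
    lookup xs i                           ≡⟨ punchIn-punchOut′ (x∉ i) ⟨
    punchIn x (punchOut′ x (lookup xs i)) ≡⟨ cong (punchIn x) (trans (sym (lookup-map i _ xs)) (trans e (lookup-map j _ xs))) ⟩
    punchIn x (punchOut′ x (lookup xs j)) ≡⟨ punchIn-punchOut′ (x∉ j) ⟩
    lookup xs j                           ∎))
    where open ≡-Reasoning

encode-decode : ∀ n c .(code : IsCode n c) → ∀ j → j < n → encode (decode n c code) j ≡ c j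
encode-decode (suc zero)    c _    zero    _ = Fin.toℕ-fromℕ< _
encode-decode (suc zero)    c _    (suc j) (s<s ())
encode-decode (suc (suc m)) c _    zero    _ = Fin.toℕ-fromℕ< _
encode-decode (suc (suc m)) c code (suc j) (s<s j<n) =
  trans (cong (λ u → encode u j) (map-punchOut′-punchIn _ (decode (suc m) (c ∘ suc) (IsCode-tail code))))
        (encode-decode (suc m) (c ∘ suc) (IsCode-tail code) j j<n)

toℕ-punchIn-< : ∀ {n} (i : Fin (suc n)) (j : Fin n) → toℕ j < toℕ i → toℕ (punchIn i j) ≡ toℕ j
toℕ-punchIn-< (suc i) zero    _         = refl
toℕ-punchIn-< (suc i) (suc j) (s<s j<i) = cong suc (toℕ-punchIn-< i j j<i)

toℕ-punchIn-≥ : ∀ {n} (i : Fin (suc n)) (j : Fin n) → toℕ i ≤ toℕ j → toℕ (punchIn i j) ≡ suc (toℕ j)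
toℕ-punchIn-≥ zero    j       _         = refl
toℕ-punchIn-≥ (suc i) (suc j) (s≤s i≤j) = cong suc (toℕ-punchIn-≥ i j i≤j)

toℕ-punchIn≤suc : ∀ {n} (i : Fin (suc n)) (j : Fin n) → toℕ (punchIn i j) ≤ suc (toℕ j)
toℕ-punchIn≤suc i j with toℕ j ℕ.<? toℕ i
... | yes j<i = ℕ.≤-trans (ℕ.≤-reflexive (toℕ-punchIn-< i j j<i)) (ℕ.n≤1+n _)
... | no  j≮i = ℕ.≤-reflexive (toℕ-punchIn-≥ i j (ℕ.≮⇒≥ j≮i))

toℕ≤toℕ-punchIn : ∀ {n} (i : Fin (suc n)) (j : Fin n) → toℕ j ≤ toℕ (punchIn i j)
toℕ≤toℕ-punchIn zero    j       = ℕ.n≤1+n _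
toℕ≤toℕ-punchIn (suc i) zero    = z≤n
toℕ≤toℕ-punchIn (suc i) (suc j) = s≤s (toℕ≤toℕ-punchIn i j)

-- The first three letters of a decoded word are a, punchIn a b and punchIn a (punchIn b d),
-- where a, b, d are read off the first three code entries.
module _ {k} (a : Fin (3 + k)) (b : Fin (2 + k)) (d : Fin (1 + k)) where
  private
    y z : Fin (3 + k)
    y = punchIn a b
    z = punchIn a (punchIn b d)

  132⇒code : a <ᶠ z → z <ᶠ y → toℕ a ≤ toℕ d × toℕ d < toℕ b
  132⇒code a<z z<y with toℕ d ℕ.<? toℕ b
  ... | no d≮b = ⊥-elim (ℕ.<-irrefl refl (ℕ.≤-<-trans (begin
      toℕ y                      ≤⟨ toℕ-punchIn≤suc a b ⟩
      suc (toℕ b)                ≤⟨ s≤s (ℕ.≮⇒≥ d≮b) ⟩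
      suc (toℕ d)                ≡⟨ toℕ-punchIn-≥ b d (ℕ.≮⇒≥ d≮b) ⟨
      toℕ (punchIn b d)          ≤⟨ toℕ≤toℕ-punchIn a (punchIn b d) ⟩
      toℕ z                      ∎) z<y))
    where open ℕ.≤-Reasoning
  ... | yes d<b with toℕ (punchIn b d) ℕ.<? toℕ a
  ...   | yes bd<a = ⊥-elim (ℕ.<-asym bd<a (subst (toℕ a <_) (toℕ-punchIn-< a (punchIn b d) bd<a) a<z))
  ...   | no  bd≮a = subst (toℕ a ≤_) (toℕ-punchIn-< b d d<b) (ℕ.≮⇒≥ bd≮a) , d<b

  code⇒values : toℕ a ≤ toℕ d → toℕ d < toℕ b → toℕ y ≡ suc (toℕ b) × toℕ z ≡ suc (toℕ d)
  code⇒values a≤d d<b =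
    toℕ-punchIn-≥ a b (ℕ.≤-trans a≤d (ℕ.<⇒≤ d<b)) ,
    trans (toℕ-punchIn-≥ a (punchIn b d) (subst (toℕ a ≤_) (sym (toℕ-punchIn-< b d d<b)) a≤d))
          (cong suc (toℕ-punchIn-< b d d<b))

  code⇒132 : toℕ a ≤ toℕ d → toℕ d < toℕ b → a <ᶠ z × z <ᶠ y
  code⇒132 a≤d d<b =
    let (y≡ , z≡) = code⇒values a≤d d<b
    in subst (toℕ a <_) (sym z≡) (s≤s a≤d) , subst₂ _<_ (sym z≡) (sym y≡) (s<s d<b)

Shape⇒132 : ∀ P {n} {x y z w : Fin n} → Shape P x y z w → x <ᶠ z × z <ᶠ y
Shape⇒132 132-4 (x<z , z<y , _)   = x<z , z<y
Shape⇒132 142-3 (x<z , z<w , w<y) = x<z , ℕ.<-trans z<w w<y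

Shape⇒fresh : ∀ P {n} {x y z w : Fin n} → Shape P x y z w → w ≢ x × w ≢ y × w ≢ z
Shape⇒fresh 132-4 (x<z , z<y , y<w) =
  Fin.<⇒≢ (ℕ.<-trans x<z (ℕ.<-trans z<y y<w)) ∘ sym , Fin.<⇒≢ y<w ∘ sym , Fin.<⇒≢ (ℕ.<-trans z<y y<w) ∘ sym
Shape⇒fresh 142-3 (x<z , z<w , w<y) =
  Fin.<⇒≢ (ℕ.<-trans x<z z<w) ∘ sym , Fin.<⇒≢ w<y , Fin.<⇒≢ z<w ∘ sym

headTarget : Pattern → ∀ {k} → Fin (1 + k) → ℕ
headTarget 132-4 {k} _ = suc k
headTarget 142-3     d = suc (toℕ d)

module _ {k} {a y z : Fin (3 + k)} {b : Fin (2 + k)} {d : Fin (1 + k)}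
         (y≡ : toℕ y ≡ suc (toℕ b)) (z≡ : toℕ z ≡ suc (toℕ d)) where

  Shape⇒headTarget : ∀ P {w} → Shape P a y z w → toℕ b ≢ headTarget P d
  Shape⇒headTarget 132-4 {w} (_ , _ , y<w) b≡ =
    ℕ.<-irrefl refl (ℕ.<-≤-trans (subst (_< toℕ w) (trans y≡ (cong suc b≡)) y<w) (s≤s⁻¹ (Fin.toℕ<n w)))
  Shape⇒headTarget 142-3 {w} (_ , z<w , w<y) b≡ =
    ℕ.<-irrefl refl (ℕ.≤-<-trans (subst (_< toℕ w) z≡ z<w) (subst (toℕ w <_) (trans y≡ (cong suc b≡)) w<y))

  headTarget⇒Shape : ∀ P → a <ᶠ z → z <ᶠ y → toℕ b ≢ headTarget P d → Σ (Fin (3 + k)) (Shape P a y z)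
  headTarget⇒Shape 132-4 a<z z<y b≢ = fromℕ (2 + k) , a<z , z<y , y<top
    where
    y<top : toℕ y < toℕ (fromℕ (2 + k))
    y<top = subst₂ _<_ (sym y≡) (sym (Fin.toℕ-fromℕ (2 + k))) (s<s (ℕ.≤∧≢⇒< (s≤s⁻¹ (Fin.toℕ<n b)) b≢))
  headTarget⇒Shape 142-3 a<z z<y b≢ = fromℕ< w<3+k , a<z , z<w , w<y
    where
    d<b : toℕ d < toℕ b
    d<b = s<s⁻¹ (subst₂ _<_ z≡ y≡ z<y)
    1+d<b : suc (toℕ d) < toℕ b
    1+d<b = ℕ.≤∧≢⇒< d<b (b≢ ∘ sym)
    w<3+k : 2 + toℕ d < 3 + k
    w<3+k = s<s (ℕ.<-≤-trans 1+d<b (ℕ.<⇒≤ (Fin.toℕ<n b)))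
    z<w : z <ᶠ fromℕ< w<3+k
    z<w = subst₂ _<_ (sym z≡) (sym (Fin.toℕ-fromℕ< w<3+k)) (ℕ.n<1+n _)
    w<y : fromℕ< w<3+k <ᶠ y
    w<y = subst₂ _<_ (sym (Fin.toℕ-fromℕ< w<3+k)) (sym y≡) (s<s 1+d<b)

lookup-after-prefix : ∀ {n k} (x y z : Fin n) (r : Vec (Fin n) k) {w} i → lookup (x ∷ y ∷ z ∷ r) i ≡ w →
                      w ≢ x × w ≢ y × w ≢ z → Σ (Fin k) λ t → lookup r t ≡ w
lookup-after-prefix x y z r 0F                  e (w≢x , _ , _) = ⊥-elim (w≢x (sym e))
lookup-after-prefix x y z r 1F                  e (_ , w≢y , _) = ⊥-elim (w≢y (sym e))
lookup-after-prefix x y z r 2F                  e (_ , _ , w≢z) = ⊥-elim (w≢z (sym e))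
lookup-after-prefix x y z r (suc (suc (suc t))) e _             = t , e

module _ {k} (a : Fin (3 + k)) (b : Fin (2 + k)) (d : Fin (1 + k)) {m} (rest : Vec (Fin (3 + k)) m) where
  private
    y z : Fin (3 + k)
    y = punchIn a b
    z = punchIn a (punchIn b d)

  head-occurrence⇒code : ∀ P → OccursAtHead (Shape P) a y z rest →
                         toℕ a ≤ toℕ d × toℕ d < toℕ b × toℕ b ≢ headTarget P d
  head-occurrence⇒code P (_ , s) =
    let (a<z , z<y) = Shape⇒132 P s
        (a≤d , d<b) = 132⇒code a b d a<z z<y
        (y≡ , z≡)   = code⇒values a b d a≤d d<b
    in a≤d , d<b , Shape⇒headTarget y≡ z≡ P s

  code⇒head-occurrence : ∀ P → (∀ w → Σ (Fin (3 + m)) λ i → lookup (a ∷ y ∷ z ∷ rest) i ≡ w) →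
                         toℕ a ≤ toℕ d → toℕ d < toℕ b → toℕ b ≢ headTarget P d → OccursAtHead (Shape P) a y z rest
  code⇒head-occurrence P surj a≤d d<b b≢ =
    let (y≡ , z≡)   = code⇒values a b d a≤d d<b
        (a<z , z<y) = code⇒132 a b d a≤d d<b
        (w , s)     = headTarget⇒Shape y≡ z≡ P a<z z<y b≢
        (i , i↦w)   = surj w
        (t , t↦w)   = lookup-after-prefix a y z rest i i↦w (Shape⇒fresh P s)
    in t , subst (Shape P a y z) (sym t↦w) s

-- Positions j-1, j, j+1 of the decoded word carry a consecutive 132, with the 3 at j.
Is132At : ℕ → (ℕ → ℕ) → ℕ → Set
Is132At n c zero    = ⊥
Is132At n c (suc i) = 2 + i < n × c i ≤ c (2 + i) × c (2 + i) < c (suc i)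

Is132At? : ∀ n c j → Dec (Is132At n c j)
Is132At? n c zero    = no λ ()
Is132At? n c (suc i) = (2 + i ℕ.<? n) ×-dec (c i ℕ.≤? c (2 + i)) ×-dec (c (2 + i) ℕ.<? c (suc i))

Is132At-suc : ∀ n c j → Is132At n (c ∘ suc) j → Is132At (suc n) c (suc j)
Is132At-suc n c (suc i) (i<n , at132) = s<s i<n , at132

target : Pattern → ℕ → (ℕ → ℕ) → ℕ → ℕ
target 132-4 n c j = n ∸ suc j
target 142-3 n c j = suc (c (suc j))

target-suc : ∀ P n c j → target P n (c ∘ suc) j ≡ target P (suc n) c (suc j)
target-suc 132-4 n c j = refl
target-suc 142-3 n c j = refl

headTarget≡target : ∀ P {k} (d : Fin (1 + k)) c → toℕ d ≡ c 2 → headTarget P d ≡ target P (3 + k) c 1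
headTarget≡target 132-4 d c _  = refl
headTarget≡target 142-3 d c d≡ = cong suc d≡

Violation : Pattern → ℕ → (ℕ → ℕ) → Set
Violation P n c = Σ ℕ λ j → Is132At n c j × c j ≢ target P n c j

CodeAvoids : Pattern → ℕ → (ℕ → ℕ) → Set
CodeAvoids P n c = ∀ j → Is132At n c j → c j ≡ target P n c j

Violation-suc : ∀ P n c → Violation P n (c ∘ suc) → Violation P (suc n) c
Violation-suc P n c (j , at132 , c≢) = suc j , Is132At-suc n c j at132 , c≢ ∘ λ e → trans e (sym (target-suc P n c j))

module _ {k} (c : ℕ → ℕ) .(code : IsCode (3 + k) c) where
  private
    a : Fin (3 + k)
    a = fromℕ< (IsCode-head code)
    b : Fin (2 + k)
    b = fromℕ< (IsCode-head (IsCode-tail code))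
    d : Fin (1 + k)
    d = fromℕ< (IsCode-head (IsCode-tail (IsCode-tail code)))
    rest : Vec (Fin (3 + k)) k
    rest = map (punchIn a) (map (punchIn b) (map (punchIn d) (decode k (λ j → c (3 + j)) (IsCode-tail (IsCode-tail (IsCode-tail code))))))
    a≡ : toℕ a ≡ c 0
    a≡ = Fin.toℕ-fromℕ< _
    b≡ : toℕ b ≡ c 1
    b≡ = Fin.toℕ-fromℕ< _
    d≡ : toℕ d ≡ c 2
    d≡ = Fin.toℕ-fromℕ< _

  head-occurrence⇒Violation : ∀ P → OccursAtHead (Shape P) a (punchIn a b) (punchIn a (punchIn b d)) rest → Violation P (3 + k) c
  head-occurrence⇒Violation P head =
    let (a≤d , d<b , b≢) = head-occurrence⇒code a b d rest P head
    in 1 , (s<s (s<s z<s) , subst₂ _≤_ a≡ d≡ a≤d , subst₂ _<_ d≡ b≡ d<b)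
         , b≢ ∘ λ e → trans b≡ (trans e (sym (headTarget≡target P d c d≡)))

  Is132At-1⇒head-occurrence : ∀ P → Is132At (3 + k) c 1 → c 1 ≢ target P (3 + k) c 1 →
                              OccursAtHead (Shape P) a (punchIn a b) (punchIn a (punchIn b d)) rest
  Is132At-1⇒head-occurrence P (_ , c0≤c2 , c2<c1) c1≢ =
    code⇒head-occurrence a b d rest P (decode-surjective _ c code)
      (subst₂ _≤_ (sym a≡) (sym d≡) c0≤c2) (subst₂ _<_ (sym d≡) (sym b≡) c2<c1)
      (c1≢ ∘ λ e → trans (sym b≡) (trans e (headTarget≡target P d c d≡)))

Occurs⇒Violation : ∀ P n c .(code : IsCode n c) → Occurs (Shape P) (decode n c code) → Violation P n c
Occurs⇒Violation P (suc (suc (suc k))) c code (inj₁ head) = head-occurrence⇒Violation c code P head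
Occurs⇒Violation P (suc (suc (suc k))) c code (inj₂ o)    =
  Violation-suc P _ c (Occurs⇒Violation P _ (c ∘ suc) (IsCode-tail code)
                         (Occurs-unpunchIn P (fromℕ< (IsCode-head code)) _ o))

Violation⇒Occurs : ∀ P n c .(code : IsCode n c) → Violation P n c → Occurs (Shape P) (decode n c code)
Violation⇒Occurs P (suc (suc (suc k))) c code (1 , at132 , c≢) = inj₁ (Is132At-1⇒head-occurrence c code P at132 c≢)
Violation⇒Occurs P (suc n) c code (suc (suc i) , (s<s i<n , at132) , c≢) =
  Occurs-∷ _ _ (Occurs-punchIn P (fromℕ< (IsCode-head code)) _
    (Violation⇒Occurs P n (c ∘ suc) (IsCode-tail code) (suc i , (i<n , at132) , c≢ ∘ λ e → trans e (target-suc P n c (suc i)))))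
Violation⇒Occurs P 0 c code (1 , (() , _) , _)
Violation⇒Occurs P 1 c code (1 , (s<s () , _) , _)
Violation⇒Occurs P 2 c code (1 , (s<s (s<s ()) , _) , _)

Avoids-decode⇒CodeAvoids : ∀ P n c .(code : IsCode n c) → Avoids (decode n c code) ⟦ P ⟧ → CodeAvoids P n c
Avoids-decode⇒CodeAvoids P n c code avoids j at132 with c j ℕ.≟ target P n c j
... | yes c≡ = c≡
... | no  c≢ = ⊥-elim (avoids (Shape⇒Contains P _ (Violation⇒Occurs P n c code (j , at132 , c≢))))

CodeAvoids⇒Avoids-decode : ∀ P n c .(code : IsCode n c) → CodeAvoids P n c → Avoids (decode n c code) ⟦ P ⟧
CodeAvoids⇒Avoids-decode P n c code avoids contains
  with j , at132 , c≢ ← Occurs⇒Violation P n c code (Contains⇒Shape P _ contains) = c≢ (avoids j at132)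

-- Retargeting codes

Is132At⇒suc<n : ∀ {n c j} → Is132At n c j → suc j < n
Is132At⇒suc<n {j = suc i} (2+i<n , _) = 2+i<n

Is132At-adjacent : ∀ n c j → Is132At n c j → ¬ Is132At n c (suc j)
Is132At-adjacent n c (suc i) (_ , _ , c2<c1) (_ , c1≤c3 , c3<c2) = ℕ.<-asym c2<c1 (ℕ.≤-<-trans c1≤c3 c3<c2)

Is132At-cong : ∀ {n c c′} → (∀ j → j < n → c j ≡ c′ j) → ∀ j → Is132At n c j → Is132At n c′ j
Is132At-cong {n} eq (suc i) (2+i<n , c0≤c2 , c2<c1) =
  2+i<n , subst₂ _≤_ (eq i (ℕ.<-trans (ℕ.n<1+n _) 1+i<n)) (eq (2 + i) 2+i<n) c0≤c2 , subst₂ _<_ (eq (2 + i) 2+i<n) (eq (suc i) 1+i<n) c2<c1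
  where
  1+i<n : suc i < n
  1+i<n = ℕ.<-trans (ℕ.n<1+n _) 2+i<n

IsCode⇒≤ : ∀ {n c} → IsCode n c → ∀ j → j < n → c j ≤ n ∸ suc j
IsCode⇒≤ {n} {c} code j j<n = ℕ.m+n≤o⇒m≤o∸n (c j) (subst (_≤ n) (sym (ℕ.+-suc (c j) j)) (code j j<n))

target-above : ∀ P n c {j} → IsCode n c → Is132At n c j → c (suc j) < target P n c j
target-above 132-4 n c {suc i} code (2+i<n , _ , c2<c1) =
  ℕ.<-≤-trans c2<c1 (IsCode⇒≤ code (suc i) (ℕ.<-trans (ℕ.n<1+n _) 2+i<n))
target-above 142-3 n c _ _ = ℕ.n<1+n _

target-isCode : ∀ P n c {j} → IsCode n c → Is132At n c j → target P n c j + j < n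
target-isCode 132-4 n c {j} _ at132 = ℕ.≤-reflexive (trans (sym (ℕ.+-suc (n ∸ suc j) j)) (ℕ.m∸n+n≡m (ℕ.<⇒≤ (Is132At⇒suc<n {c = c} at132))))
target-isCode 142-3 n c {j} code at132 = subst (_< n) (ℕ.+-suc (c (suc j)) j) (code (suc j) (Is132At⇒suc<n {c = c} at132))

retarget : Pattern → ℕ → (ℕ → ℕ) → ℕ → ℕ
retarget P n c j with Is132At? n c j
... | yes _ = target P n c j
... | no  _ = c j

module _ (P : Pattern) (n : ℕ) (c : ℕ → ℕ) where

  retarget-at132 : ∀ {j} → Is132At n c j → retarget P n c j ≡ target P n c j
  retarget-at132 {j} at132 with Is132At? n c j
  ... | yes _      = refl
  ... | no ¬at132 = ⊥-elim (¬at132 at132)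

  retarget-¬at132 : ∀ {j} → ¬ Is132At n c j → retarget P n c j ≡ c j
  retarget-¬at132 {j} ¬at132 with Is132At? n c j
  ... | yes at132 = ⊥-elim (¬at132 at132)
  ... | no _      = refl

  retarget-isCode : IsCode n c → IsCode n (retarget P n c)
  retarget-isCode code j j<n with Is132At? n c j
  ... | yes at132 = target-isCode P n c code at132
  ... | no _      = code j j<n

  retarget-above : IsCode n c → ∀ {j} → Is132At n c j → c (suc j) < retarget P n c j
  retarget-above code at132 = subst (c _ <_) (sym (retarget-at132 at132)) (target-above P n c code at132)

  Is132At-retarget⁺ : IsCode n c → ∀ j → Is132At n c j → Is132At n (retarget P n c) j
  Is132At-retarget⁺ code (suc i) at132@(2+i<n , c0≤c2 , _) =
    2+i<n , subst₂ _≤_ (sym c0′) (sym c2′) c0≤c2 , subst (_< retarget P n c (suc i)) (sym c2′) (retarget-above code at132)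
    where
    c0′ : retarget P n c i ≡ c i
    c0′ = retarget-¬at132 (λ at132′ → Is132At-adjacent n c i at132′ at132)
    c2′ : retarget P n c (2 + i) ≡ c (2 + i)
    c2′ = retarget-¬at132 (Is132At-adjacent n c (suc i) at132)

  Is132At-retarget⁻ : IsCode n c → ∀ j → Is132At n (retarget P n c) j → Is132At n c j
  Is132At-retarget⁻ code (suc i) (2+i<n , c0′≤c2′ , c2′<c1′) =
    by-neighbours (Is132At? n c i) (Is132At? n c (suc i)) (Is132At? n c (2 + i))
    where
    by-neighbours : Dec (Is132At n c i) → Dec (Is132At n c (suc i)) → Dec (Is132At n c (2 + i)) → Is132At n c (suc i)
    by-neighbours _ (yes at132) _ = at132
    by-neighbours (yes at132₀) (no ¬at132) _ =
      ⊥-elim (ℕ.<-asym (ℕ.≤-<-trans c0′≤c2′ (subst (retarget P n c (2 + i) <_) (retarget-¬at132 ¬at132) c2′<c1′)) (retarget-above code at132₀))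
    by-neighbours (no _) (no ¬at132) (yes at132₂) =
      ⊥-elim (ℕ.<-asym (subst (retarget P n c (2 + i) <_) (retarget-¬at132 ¬at132) c2′<c1′)
                       (ℕ.≤-<-trans (proj₁ (proj₂ at132₂)) (retarget-above code at132₂)))
    by-neighbours (no ¬at132₀) (no ¬at132) (no ¬at132₂) =
      2+i<n , subst₂ _≤_ (retarget-¬at132 ¬at132₀) (retarget-¬at132 ¬at132₂) c0′≤c2′
            , subst₂ _<_ (retarget-¬at132 ¬at132₂) (retarget-¬at132 ¬at132) c2′<c1′

target-retarget : ∀ P P′ n c j → Is132At n c j → target P n (retarget P′ n c) j ≡ target P n c j
target-retarget 132-4 P′ n c j _     = refl
target-retarget 142-3 P′ n c j at132 = cong suc (retarget-¬at132 P′ n c (Is132At-adjacent n c j at132))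

retarget-avoids : ∀ P n c → IsCode n c → CodeAvoids P n (retarget P n c)
retarget-avoids P n c code j at132′ =
  trans (retarget-at132 P n c at132) (sym (target-retarget P P n c j at132))
  where
  at132 : Is132At n c j
  at132 = Is132At-retarget⁻ P n c code j at132′

retarget-retarget : ∀ P P′ n c → IsCode n c → CodeAvoids P n c → ∀ j → retarget P n (retarget P′ n c) j ≡ c j
retarget-retarget P P′ n c code avoids j with Is132At? n c j
... | yes at132 = begin
  retarget P n (retarget P′ n c) j ≡⟨ retarget-at132 P n _ (Is132At-retarget⁺ P′ n c code j at132) ⟩
  target P n (retarget P′ n c) j   ≡⟨ target-retarget P P′ n c j at132 ⟩
  target P n c j                   ≡⟨ avoids j at132 ⟨
  c j                              ∎
  where open ≡-Reasoning
... | no ¬at132 = trans (retarget-¬at132 P n _ (¬at132 ∘ Is132At-retarget⁻ P′ n c code j)) (retarget-¬at132 P′ n c ¬at132)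

retarget-cong : ∀ P n {c c′} → (∀ j → j < n → c j ≡ c′ j) → ∀ j → j < n → retarget P n c j ≡ retarget P n c′ j
retarget-cong P n {c} {c′} eq j j<n with Is132At? n c j | Is132At? n c′ j
... | yes at132 | yes _ = target-cong P at132
  where
  target-cong : ∀ P → Is132At n c j → target P n c j ≡ target P n c′ j
  target-cong 132-4 _     = refl
  target-cong 142-3 at132 = cong suc (eq (suc j) (Is132At⇒suc<n {c = c} at132))
... | no _      | no _      = eq j j<n
... | yes at132 | no ¬at132′ = ⊥-elim (¬at132′ (Is132At-cong eq j at132))
... | no ¬at132 | yes at132′ = ⊥-elim (¬at132 (Is132At-cong (λ j j<n → sym (eq j j<n)) j at132′))

retargetPerm : Pattern → ∀ n → Vec (Fin n) n → Vec (Fin n) n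
retargetPerm P n π = decode n (retarget P n (encode π)) (retarget-isCode P n (encode π) (encode-isCode π))

retargetPerm-isPerm : ∀ P n π → IsPerm (retargetPerm P n π)
retargetPerm-isPerm P n π = decode-isPerm n _ _

retargetPerm-avoids : ∀ P n π → Avoids (retargetPerm P n π) ⟦ P ⟧
retargetPerm-avoids P n π = CodeAvoids⇒Avoids-decode P n _ _ (retarget-avoids P n _ (encode-isCode π))

retargetPerm-inverse : ∀ P P′ n π → IsPerm π → Avoids π ⟦ P ⟧ → retargetPerm P n (retargetPerm P′ n π) ≡ π
retargetPerm-inverse P P′ n π perm avoids = trans (decode-cong n _ _ _ _ codes≡) (decode-encode π perm code)
  where
  c : ℕ → ℕ
  c = encode π
  code : IsCode n c
  code = encode-isCode π
  c-avoids : CodeAvoids P n c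
  c-avoids = Avoids-decode⇒CodeAvoids P n c code (subst (λ σ → Avoids σ ⟦ P ⟧) (sym (decode-encode π perm code)) avoids)
  codes≡ : ∀ j → j < n → retarget P n (encode (retargetPerm P′ n π)) j ≡ c j
  codes≡ j j<n = trans (retarget-cong P n (encode-decode n _ (retarget-isCode P′ n c code)) j j<n)
                       (retarget-retarget P P′ n c code c-avoids j)

-- retarget never changes the code entry 0, so both words decode to the same first letter.
retargetPerm-head : ∀ P k (π : Vec (Fin (suc k)) (suc k)) → IsPerm π → lookup (retargetPerm P (suc k) π) 0F ≡ lookup π 0F
retargetPerm-head P k π perm = cong (λ σ → lookup σ 0F) (decode-encode π perm (encode-isCode π))

-- Membership proofs of Av and AvFirst are irrelevant, so equations derived from them are recomputed.
recompute-≡ : ∀ {n} {σ τ : Vec (Fin n) n} → .(σ ≡ τ) → σ ≡ τ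
recompute-≡ {σ = σ} {τ} = recompute (≡-dec Fin._≟_ σ τ)

Av-≡ : ∀ {n p} {x y : Av n p} → Av.word x ≡ Av.word y → x ≡ y
Av-≡ {x = av _ _ _} {av _ _ _} refl = refl

AvFirst-≡ : ∀ {k a p} {x y : AvFirst k a p} → AvFirst.word x ≡ AvFirst.word y → x ≡ y
AvFirst-≡ {x = avf _ _ _ _} {avf _ _ _ _} refl = refl

Av-↔ : ∀ P P′ n → Av n ⟦ P ⟧ ↔ Av n ⟦ P′ ⟧
Av-↔ P P′ n = mk↔ₛ′ (retargetAv P′) (retargetAv P) (inverse P′ P) (inverse P P′)
  where
  retargetAv : ∀ Q {R} → Av n ⟦ R ⟧ → Av n ⟦ Q ⟧
  retargetAv Q x = av (retargetPerm Q n (Av.word x)) (retargetPerm-isPerm Q n (Av.word x)) (retargetPerm-avoids Q n (Av.word x))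
  inverse : ∀ Q R (x : Av n ⟦ Q ⟧) → retargetAv Q (retargetAv R x) ≡ x
  inverse Q R (av π perm avoids) = Av-≡ (recompute-≡ (retargetPerm-inverse Q R n π perm avoids))

AvFirst-↔ : ∀ P P′ k a → AvFirst k a ⟦ P ⟧ ↔ AvFirst k a ⟦ P′ ⟧
AvFirst-↔ P P′ k a = mk↔ₛ′ (retargetAvFirst P′) (retargetAvFirst P) (inverse P′ P) (inverse P P′)
  where
  retargetAvFirst : ∀ Q {R} → AvFirst k a ⟦ R ⟧ → AvFirst k a ⟦ Q ⟧
  retargetAvFirst Q (avf π perm _ first) =
    avf (retargetPerm Q (suc k) π) (retargetPerm-isPerm Q (suc k) π) (retargetPerm-avoids Q (suc k) π)
        (trans (retargetPerm-head Q k π perm) first)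
  inverse : ∀ Q R (x : AvFirst k a ⟦ Q ⟧) → retargetAvFirst Q (retargetAvFirst R x) ≡ x
  inverse Q R (avf π perm avoids _) = AvFirst-≡ (recompute-≡ (retargetPerm-inverse Q R (suc k) π perm avoids))

corollary4p4 : (∀ (n : ℕ) → Av n p132-4 ↔ Av n p142-3)
    × (∀ (k : ℕ) (a : Fin (suc k)) → AvFirst k a p132-4 ↔ AvFirst k a p142-3)
corollary4p4 = Av-↔ 132-4 142-3 , AvFirst-↔ 132-4 142-3
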